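{- For all packed words $u,v$, $$\Delta(u*v)=\Delta(u)*^{\otimes 2}\Delta(v),$$ where $*^{\otimes 2}$ is the product on $\mathcal{H}\otimes\mathcal{H}$ given by $(a\otimes b)*^{\otimes2}(c\otimes d)=(a*c)\otimes(b*d)$, extended bilinearly.
   Context: Let $k$ be a field, $X=\{x_i\}_{i\ge 0}$ an alphabet indexed by the nonnegative integers and $X^*$ the set of words over $X$, with empty word $1_{X^*}$. For a word $w=x_{i_1}\cdots x_{i_m}$, $|w|=m$, $w[j]$ is its $j$-th letter, $Alph(w)$ the set of letters occurring in $w$, $IAlph(w)=\{i_1,\dots,i_m\}$, $sup(w)=\max IAlph(w)$ ($sup(w)=0$ if $IAlph(w)=\emptyset$). For $\phi$ on $IAlph(w)$ with values in $\mathbb{N}$ and $\phi(0)=0$, $S_\phi(w)=x_{\phi(i_1)}\cdots x_{\phi(i_m)}$. If $IAlph(w)\setminus\{0\}=\{j_1<\dots<j_k\}$, let $\phi_w(j_m)=m$, $\phi_w(0)=0$, $pack(w)=S_{\phi_w}(w)$; $w$ is packed if $pack(w)=w$. For $t\in\mathbb{N}$, $T_t(w)=S_\phi(w)$ with $\phi(0)=0$, $\phi(n)=n+t$ for $n>0$. Shifted concatenation: $u*v=u\,T_{sup(u)}(v)$. $\mathcal{H}$ is the $k$-vector space with basis the packed words, with product $*$ extended bilinearly. For $L=\{l_1<\dots<l_r\}\subseteq[1\dots|w|]$, $w[L]=w[l_1]\cdots w[l_r]$. For $A\subseteq X$, $w/A=S_{\phi_A}(w)$ where $\phi_A(i)=0$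 if $x_i\in A$ and $\phi_A(i)=i$ otherwise; ${}^{w}/_{u}=w/Alph(u)$. The coproduct $\Delta:\mathcal{H}\to\mathcal{H}\otimes\mathcal{H}$ is defined on packed words by $\Delta(w)=\sum pack(w[I])\otimes pack({}^{w[J]}/_{w[I]})$, the sum over ordered pairs $(I,J)$ of disjoint sets with $I\cup J=[1\dots|w|]$, extended linearly. -}

module Defs where

open import Level using (Level; _⊔_; suc)
open import Data.Bool using (Bool; true; false; if_then_else_; not; _∧_)
open import Data.Nat as ℕ using (ℕ; zero; _≡ᵇ_; _≤ᵇ_) renaming (_+_ to _+ℕ_; _⊔_ to _⊔ℕ_)
open import Data.List using (List; []; _∷_; map; foldr; length; applyUpTo; concatMap; _++_)
open import Data.Product using (_×_; _,_; Σ)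
open import Relation.Binary.PropositionalEquality using (_≡_)
open import Relation.Nullary using (¬_)
open import Algebra.Bundles using (CommutativeRing)

record Field (c ℓ : Level) : Set (suc (c ⊔ ℓ)) where
  field
    commutativeRing : CommutativeRing c ℓ
  open CommutativeRing commutativeRing public
  field
    1≉0     : ¬ (1# ≈ 0#)
    inverse : ∀ x → ¬ (x ≈ 0#) → Σ Carrier (λ y → (x * y) ≈ 1#)

-- Words over X = {x_i}: the word x_{i1}...x_{im} is the list i1 ∷ ... ∷ im.

Word : Set
Word = List ℕ

_∈ᵇ_ : ℕ → Word → Bool
i ∈ᵇ []      = false
i ∈ᵇ (j ∷ w) = if i ≡ᵇ j then true else (i ∈ᵇ w)

countᵇ : (ℕ → Bool) → List ℕ → ℕ
countᵇ p []      = 0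
countᵇ p (x ∷ l) = if p x then ℕ.suc (countᵇ p l) else countᵇ p l

sup : Word → ℕ
sup = foldr _⊔ℕ_ 0

T : ℕ → Word → Word
T t = map (λ n → if n ≡ᵇ 0 then 0 else n +ℕ t)

_⋆_ : Word → Word → Word
u ⋆ v = u ++ T (sup u) v

-- φ_w(j) = rank of j among the nonzero letter indices occurring in w,
-- i.e. the number of m ∈ {1,...,j} with m ∈ IAlph(w); φ_w(0) = 0.
φ : Word → ℕ → ℕ
φ w j = countᵇ (λ m → m ∈ᵇ w) (applyUpTo ℕ.suc j)

pack : Word → Word
pack w = map (φ w) w

Packed : Word → Set
Packed w = pack w ≡ w

-- w[I] for a subset I of positions given as a Boolean mask
select : List Bool → Word → Word
select []          _       = []
select (_ ∷ _)     []      = []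
select (true ∷ m)  (x ∷ w) = x ∷ select m w
select (false ∷ m) (x ∷ w) = select m w

quot : Word → Word → Word
quot w u = map (λ i → if i ∈ᵇ u then 0 else i) w

masks : ℕ → List (List Bool)
masks zero        = [] ∷ []
masks (ℕ.suc n)   = map (true ∷_) (masks n) ++ map (false ∷_) (masks n)

-- Elements of H ⊗ H with natural-number multiplicities are represented as
-- formal sums, i.e. lists of basis tensors a ⊗ b (as pairs (a , b)).

Tensor : Set
Tensor = List (Word × Word)

Δ : Word → Tensor
Δ w = map (λ I → pack (select I w) , pack (quot (select (map not I) w) (select I w)))
          (masks (length w))

_⋆⊗_ : Tensor → Tensor → Tensor
S ⋆⊗ S' = concatMap (λ { (a , b) → map (λ { (c , d) → (a ⋆ c , b ⋆ d) }) S' }) S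

_==_ : Word → Word → Bool
[]      == []      = true
(x ∷ u) == (y ∷ v) = (x ≡ᵇ y) ∧ (u == v)
_       == _       = false

module _ {c ℓ : Level} (k : Field c ℓ) where
  open Field k

  coeff : Word → Word → Tensor → Carrier
  coeff a b = foldr (λ { (a' , b') acc → (if (a == a') ∧ (b == b') then 1# else 0#) + acc }) 0#

  _≈⊗_ : Tensor → Tensor → Set ℓ
  S ≈⊗ S' = ∀ a b → coeff a b S ≈ coeff a b S'

-- We prove the stronger statement that the two formal sums are equal as lists
-- of basis tensors (term by term, in the same order), for arbitrary words u, v;
-- equality of all coefficients then follows at once.  Let t = sup(u).
--
--  * Masks of length |u| + |v| are exactly the concatenations I ++ J of a mask I
--    of length |u| and a mask J of length |v|, enumerated in the order in which
--    the product *⊗² enumerates pairs of terms (masks-++).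
--  * For such a mask, (u * v)[I ++ J] = u[I] T_t(v[J]), likewise for the
--    complementary mask, and the quotient splits the same way (quot-shifted).
--  * The key fact is that packing turns a "shifted" concatenation a T_t(b) with
--    sup(a) ≤ t into the shifted product pack(a) * pack(b) (pack-shifted).  It is
--    proved through rank w j = #{1 ≤ m ≤ j | x_m ∈ Alph(w)}, which computes the
--    packing map φ_w: letters ≤ t are ranked inside a, letters n + t inside b.
-- Putting these together, the term of Δ(u * v) indexed by I ++ J is the product
-- of the term of Δ(u) indexed by I and the term of Δ(v) indexed by J.
-- The argument never uses that u and v are packed: the identity holds for all
-- words.

module Submission where

open import Defs
open import Level using (Level)
open import Data.Bool using (Bool; true; false; if_then_else_; not; _∨_)
open import Data.Bool.Properties using (∨-identityʳ; if-eta)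
open import Data.Nat using (ℕ; zero; suc; pred; _+_; _≤_; _<_; _≡ᵇ_; z≤n; s≤s; _∸_)
open import Data.Nat.Properties
  using (+-comm; ≤-trans; ≤-refl; n≤1+n; m≤n+m; m∸n+n≡m; m≤m⊔n; m≤n⊔m; m≤n⇒m⊔n≡n; m≥n⇒m⊔n≡m; ⊔-lub; ≤-total;
         <⇒≢; >⇒≢; m≤n⇒m<n∨m≡n)
open import Data.List using (List; []; _∷_; map; length; applyUpTo; concatMap; _++_; _∷ʳ_)
open import Data.List.Properties
  using (map-++; map-cong; map-∘; map-id; length-++; length-map; ++-identityʳ; applyUpTo-∷ʳ;
         concatMap-++; concatMap-map; map-concatMap; concatMap-cong)
open import Data.List.Relation.Unary.All as All using (All; []; _∷_)
open import Data.List.Relation.Unary.All.Properties using (++⁺; map⁺)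
open import Data.Product using (_×_; _,_)
open import Data.Sum using (inj₁; inj₂)
open import Data.Empty using (⊥-elim)
open import Function using (_∘_)
open import Relation.Binary.PropositionalEquality
  using (_≡_; _≢_; refl; sym; trans; cong; cong₂; module ≡-Reasoning)

≡ᵇ-refl : ∀ n → (n ≡ᵇ n) ≡ true
≡ᵇ-refl zero    = refl
≡ᵇ-refl (suc n) = ≡ᵇ-refl n

≡ᵇ-false : ∀ {m n} → m ≢ n → (m ≡ᵇ n) ≡ false
≡ᵇ-false {zero}  {zero}  m≢n = ⊥-elim (m≢n refl)
≡ᵇ-false {zero}  {suc n} _   = refl
≡ᵇ-false {suc m} {zero}  _   = refl
≡ᵇ-false {suc m} {suc n} m≢n = ≡ᵇ-false (m≢n ∘ cong suc)

≡ᵇ-+ʳ : ∀ t x z → ((x + t) ≡ᵇ (z + t)) ≡ (x ≡ᵇ z)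
≡ᵇ-+ʳ t x z rewrite +-comm x t | +-comm z t = shifted t
  where
  shifted : ∀ t → ((t + x) ≡ᵇ (t + z)) ≡ (x ≡ᵇ z)
  shifted zero    = refl
  shifted (suc t) = shifted t

∈-++ : ∀ x a c → (x ∈ᵇ (a ++ c)) ≡ ((x ∈ᵇ a) ∨ (x ∈ᵇ c))
∈-++ x []      c = refl
∈-++ x (y ∷ a) c with x ≡ᵇ y
... | true  = refl
... | false = ∈-++ x a c

∈-tail : ∀ x z xs → (z ∈ᵇ xs) ≡ true → (z ∈ᵇ (x ∷ xs)) ≡ true
∈-tail x z xs z∈xs with z ≡ᵇ x
... | true  = refl
... | false = z∈xs

∈-head : ∀ x xs → (x ∈ᵇ (x ∷ xs)) ≡ true
∈-head x xs rewrite ≡ᵇ-refl x = refl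

∉-above-sup : ∀ x a → sup a < x → (x ∈ᵇ a) ≡ false
∉-above-sup x []      _ = refl
∉-above-sup x (y ∷ a) p
  rewrite ≡ᵇ-false (>⇒≢ (≤-trans (s≤s (m≤m⊔n y (sup a))) p))
  = ∉-above-sup x a (≤-trans (s≤s (m≤n⊔m y (sup a))) p)

∉-shifted : ∀ x t b → 0 < x → x ≤ t → (x ∈ᵇ T t b) ≡ false
∉-shifted x t [] _ _ = refl
∉-shifted (suc x) t (zero ∷ b) p q = ∉-shifted (suc x) t b p q
∉-shifted (suc x) t (suc z ∷ b) p q
  rewrite ≡ᵇ-false (<⇒≢ (≤-trans q (m≤n+m t z)))
  = ∉-shifted (suc x) t b p q

∈-shifted : ∀ y t b → ((suc y + t) ∈ᵇ T t b) ≡ (suc y ∈ᵇ b)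
∈-shifted y t []          = refl
∈-shifted y t (zero ∷ b)  = ∈-shifted y t b
∈-shifted y t (suc z ∷ b) rewrite ≡ᵇ-+ʳ t (suc y) (suc z) with y ≡ᵇ z
... | true  = refl
... | false = ∈-shifted y t b

rank : Word → ℕ → ℕ
rank w zero    = 0
rank w (suc j) = if suc j ∈ᵇ w then suc (rank w j) else rank w j

countᵇ-++ : ∀ p xs ys → countᵇ p (xs ++ ys) ≡ countᵇ p xs + countᵇ p ys
countᵇ-++ p []       ys = refl
countᵇ-++ p (x ∷ xs) ys with p x
... | true  = cong suc (countᵇ-++ p xs ys)
... | false = countᵇ-++ p xs ys

φ≡rank : ∀ w j → φ w j ≡ rank w j
φ≡rank w zero    = refl
φ≡rank w (suc j) = begin
  countᵇ p (applyUpTo suc (suc j))                    ≡⟨ cong (countᵇ p) (applyUpTo-∷ʳ suc j) ⟨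
  countᵇ p (applyUpTo suc j ∷ʳ suc j)                 ≡⟨ countᵇ-++ p (applyUpTo suc j) (suc j ∷ []) ⟩
  countᵇ p (applyUpTo suc j) + countᵇ p (suc j ∷ [])  ≡⟨ cong (_+ countᵇ p (suc j ∷ [])) (φ≡rank w j) ⟩
  rank w j + countᵇ p (suc j ∷ [])                    ≡⟨ add-indicator (suc j ∈ᵇ w) ⟩
  rank w (suc j)                                      ∎
  where
  open ≡-Reasoning
  p : ℕ → Bool
  p m = m ∈ᵇ w
  add-indicator : (b : Bool) → rank w j + (if b then 1 else 0) ≡ (if b then suc (rank w j) else rank w j)
  add-indicator true  = +-comm (rank w j) 1
  add-indicator false = +-comm (rank w j) 0

pack≡map-rank : ∀ w → pack w ≡ map (rank w) w
pack≡map-rank w = map-cong (φ≡rank w) w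

rank-mono : ∀ w {i j} → i ≤ j → rank w i ≤ rank w j
rank-mono w {j = zero} z≤n = ≤-refl
rank-mono w {i} {suc j} i≤1+j with m≤n⇒m<n∨m≡n i≤1+j
... | inj₁ (s≤s i≤j) = ≤-trans (rank-mono w i≤j) (step (suc j ∈ᵇ w))
  where
  step : (b : Bool) → rank w j ≤ (if b then suc (rank w j) else rank w j)
  step true  = n≤1+n (rank w j)
  step false = ≤-refl
... | inj₂ refl      = ≤-refl

rank-constant : ∀ a s d → sup a ≤ s → rank a (d + s) ≡ rank a s
rank-constant a s zero    _ = refl
rank-constant a s (suc d) p
  rewrite ∉-above-sup (suc d + s) a (s≤s (≤-trans p (m≤n+m s d))) = rank-constant a s d p

sup-map : ∀ (f : ℕ → ℕ) → (∀ {i j} → i ≤ j → f i ≤ f j) → f 0 ≡ 0 → ∀ w → sup (map f w) ≡ f (sup w)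
sup-map f mono f0 []      = sym f0
sup-map f mono f0 (x ∷ w) rewrite sup-map f mono f0 w with ≤-total x (sup w)
... | inj₁ x≤s rewrite m≤n⇒m⊔n≡n x≤s = m≤n⇒m⊔n≡n (mono x≤s)
... | inj₂ s≤x rewrite m≥n⇒m⊔n≡m s≤x = m≥n⇒m⊔n≡m (mono s≤x)

sup-pack : ∀ a t → sup a ≤ t → sup (pack a) ≡ rank a t
sup-pack a t p = begin
  sup (pack a)                      ≡⟨ cong sup (pack≡map-rank a) ⟩
  sup (map (rank a) a)              ≡⟨ sup-map (rank a) (rank-mono a) refl a ⟩
  rank a (sup a)                    ≡⟨ rank-constant a (sup a) (t ∸ sup a) ≤-refl ⟨
  rank a (t ∸ sup a + sup a)        ≡⟨ cong (rank a) (m∸n+n≡m p) ⟩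
  rank a t                          ∎
  where open ≡-Reasoning

shift : ℕ → ℕ → ℕ
shift t n = if n ≡ᵇ 0 then 0 else n + t

rank-low : ∀ a c j → (∀ x → 0 < x → x ≤ j → (x ∈ᵇ c) ≡ false) → rank (a ++ c) j ≡ rank a j
rank-low a c zero    _ = refl
rank-low a c (suc j) c-free
  rewrite ∈-++ (suc j) a c | c-free (suc j) (s≤s z≤n) ≤-refl | ∨-identityʳ (suc j ∈ᵇ a)
        | rank-low a c j (λ x 0<x x≤j → c-free x 0<x (≤-trans x≤j (n≤1+n j)))
  = refl

rank-high : ∀ a b t → sup a ≤ t → ∀ y → rank (a ++ T t b) (y + t) ≡ rank b y + rank a t
rank-high a b t _ zero = rank-low a (T t b) t (λ x → ∉-shifted x t b)
rank-high a b t p (suc y)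
  rewrite ∈-++ (suc y + t) a (T t b) | ∉-above-sup (suc y + t) a (s≤s (≤-trans p (m≤n+m t y)))
        | ∈-shifted y t b | rank-high a b t p y
  with suc y ∈ᵇ b
... | true  = refl
... | false = refl

rank-shifted-letter : ∀ a b t → sup a ≤ t → ∀ x → (x ∈ᵇ b) ≡ true →
  rank (a ++ T t b) (shift t x) ≡ shift (rank a t) (rank b x)
rank-shifted-letter a b t p zero    _   = refl
rank-shifted-letter a b t p (suc y) x∈b rewrite rank-high a b t p (suc y) | x∈b = refl

map-cong-≤ : ∀ {f g : ℕ → ℕ} t xs → sup xs ≤ t → (∀ x → x ≤ t → f x ≡ g x) → map f xs ≡ map g xs
map-cong-≤ t []       _ _    = refl
map-cong-≤ t (x ∷ xs) p f≡g =
  cong₂ _∷_ (f≡g x (≤-trans (m≤m⊔n x (sup xs)) p)) (map-cong-≤ t xs (≤-trans (m≤n⊔m x (sup xs)) p) f≡g)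

map-cong-∈ : ∀ {f g : ℕ → ℕ} xs → (∀ x → (x ∈ᵇ xs) ≡ true → f x ≡ g x) → map f xs ≡ map g xs
map-cong-∈ []       _   = refl
map-cong-∈ (x ∷ xs) f≡g =
  cong₂ _∷_ (f≡g x (∈-head x xs)) (map-cong-∈ xs (λ z z∈xs → f≡g z (∈-tail x z xs z∈xs)))

pack-shifted : ∀ a b t → sup a ≤ t → pack (a ++ T t b) ≡ pack a ⋆ pack b
pack-shifted a b t p = begin
  pack (a ++ T t b)                                    ≡⟨ pack≡map-rank (a ++ T t b) ⟩
  map r (a ++ T t b)                                   ≡⟨ map-++ r a (T t b) ⟩
  map r a ++ map r (T t b)                             ≡⟨ cong₂ _++_ low high ⟩
  pack a ++ T (rank a t) (pack b)                      ≡⟨ cong (λ s → pack a ++ T s (pack b)) (sup-pack a t p) ⟨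
  pack a ⋆ pack b                                      ∎
  where
  open ≡-Reasoning
  r : ℕ → ℕ
  r = rank (a ++ T t b)
  low : map r a ≡ pack a
  low = begin
    map r a          ≡⟨ map-cong-≤ t a p (λ x x≤t → rank-low a (T t b) x
                          (λ y 0<y y≤x → ∉-shifted y t b 0<y (≤-trans y≤x x≤t))) ⟩
    map (rank a) a   ≡⟨ pack≡map-rank a ⟨
    pack a           ∎
  high : map r (T t b) ≡ T (rank a t) (pack b)
  high = begin
    map r (map (shift t) b)                ≡⟨ map-∘ b ⟨
    map (r ∘ shift t) b                    ≡⟨ map-cong-∈ b (rank-shifted-letter a b t p) ⟩
    map (shift (rank a t) ∘ rank b) b      ≡⟨ map-∘ b ⟩
    T (rank a t) (map (rank b) b)          ≡⟨ cong (T (rank a t)) (pack≡map-rank b) ⟨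
    T (rank a t) (pack b)                  ∎

erase : Word → ℕ → ℕ
erase u i = if i ∈ᵇ u then 0 else i

erase-low : ∀ a b t x → x ≤ t → erase (a ++ T t b) x ≡ erase a x
erase-low a b t zero    _   rewrite if-eta (0 ∈ᵇ (a ++ T t b)) {0} | if-eta (0 ∈ᵇ a) {0} = refl
erase-low a b t (suc x) x≤t
  rewrite ∈-++ (suc x) a (T t b) | ∉-shifted (suc x) t b (s≤s z≤n) x≤t | ∨-identityʳ (suc x ∈ᵇ a)
  = refl

erase-shifted : ∀ a b t → sup a ≤ t → ∀ x → erase (a ++ T t b) (shift t x) ≡ shift t (erase b x)
erase-shifted a b t _ zero rewrite if-eta (0 ∈ᵇ (a ++ T t b)) {0} | if-eta (0 ∈ᵇ b) {0} = refl
erase-shifted a b t p (suc y)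
  rewrite ∈-++ (suc y + t) a (T t b) | ∉-above-sup (suc y + t) a (s≤s (≤-trans p (m≤n+m t y)))
        | ∈-shifted y t b
  with suc y ∈ᵇ b
... | true  = refl
... | false = refl

quot-shifted : ∀ a b c d t → sup a ≤ t → sup c ≤ t →
  quot (c ++ T t d) (a ++ T t b) ≡ quot c a ++ T t (quot d b)
quot-shifted a b c d t p q = begin
  map e (c ++ T t d)                         ≡⟨ map-++ e c (T t d) ⟩
  map e c ++ map e (map (shift t) d)         ≡⟨ cong₂ _++_ (map-cong-≤ t c q (erase-low a b t)) (sym (map-∘ d)) ⟩
  quot c a ++ map (e ∘ shift t) d            ≡⟨ cong (quot c a ++_) (map-cong (erase-shifted a b t p) d) ⟩
  quot c a ++ map (shift t ∘ erase b) d      ≡⟨ cong (quot c a ++_) (map-∘ d) ⟩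
  quot c a ++ T t (quot d b)                 ∎
  where
  open ≡-Reasoning
  e : ℕ → ℕ
  e = erase (a ++ T t b)

sup-map-≤ : ∀ (f : ℕ → ℕ) → (∀ x → f x ≤ x) → ∀ w → sup (map f w) ≤ sup w
sup-map-≤ f f≤ []      = z≤n
sup-map-≤ f f≤ (x ∷ w) = ⊔-lub (≤-trans (f≤ x) (m≤m⊔n x (sup w))) (≤-trans (sup-map-≤ f f≤ w) (m≤n⊔m x (sup w)))

erase-≤ : ∀ u x → erase u x ≤ x
erase-≤ u x with x ∈ᵇ u
... | true  = z≤n
... | false = ≤-refl

sup-select : ∀ I w → sup (select I w) ≤ sup w
sup-select []          w       = z≤n
sup-select (_ ∷ _)     []      = z≤n
sup-select (true ∷ I)  (x ∷ w) = ⊔-lub (m≤m⊔n x (sup w)) (≤-trans (sup-select I w) (m≤n⊔m x (sup w)))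
sup-select (false ∷ I) (x ∷ w) = ≤-trans (sup-select I w) (m≤n⊔m x (sup w))

select-++ : ∀ I J (u w : Word) → length I ≡ length u → select (I ++ J) (u ++ w) ≡ select I u ++ select J w
select-++ []          J []      w _ = refl
select-++ (true ∷ I)  J (x ∷ u) w p = cong (x ∷_) (select-++ I J u w (cong pred p))
select-++ (false ∷ I) J (x ∷ u) w p = select-++ I J u w (cong pred p)

select-map : ∀ (f : ℕ → ℕ) I w → select I (map f w) ≡ map f (select I w)
select-map f []          w       = refl
select-map f (_ ∷ _)     []      = refl
select-map f (true ∷ I)  (x ∷ w) = cong (f x ∷_) (select-map f I w)
select-map f (false ∷ I) (x ∷ w) = select-map f I w

select-⋆ : ∀ I J u v → length I ≡ length u → select (I ++ J) (u ⋆ v) ≡ select I u ++ T (sup u) (select J v)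
select-⋆ I J u v p = trans (select-++ I J u (T (sup u) v) p) (cong (select I u ++_) (select-map (shift (sup u)) J v))

masks-length : ∀ n → All (λ I → length I ≡ n) (masks n)
masks-length zero    = refl ∷ []
masks-length (suc n) = ++⁺ (map⁺ (All.map (cong suc) (masks-length n))) (map⁺ (All.map (cong suc) (masks-length n)))

masks-++ : ∀ n m → masks (n + m) ≡ concatMap (λ I → map (I ++_) (masks m)) (masks n)
masks-++ zero m = sym (trans (++-identityʳ (map (λ J → J) (masks m))) (map-id (masks m)))
masks-++ (suc n) m = begin
  map (true ∷_) (masks (n + m)) ++ map (false ∷_) (masks (n + m))  ≡⟨ cong₂ _++_ (prefix true) (prefix false) ⟩
  concatMap glue (map (true ∷_) M) ++ concatMap glue (map (false ∷_) M)
                                                                    ≡⟨ concatMap-++ glue (map (true ∷_) M) (map (false ∷_) M) ⟨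
  concatMap glue (map (true ∷_) M ++ map (false ∷_) M)              ∎
  where
  open ≡-Reasoning
  M : List (List Bool)
  M = masks n
  glue : List Bool → List (List Bool)
  glue I = map (I ++_) (masks m)
  prefix : ∀ x → map (x ∷_) (masks (n + m)) ≡ concatMap glue (map (x ∷_) M)
  prefix x = begin
    map (x ∷_) (masks (n + m))                         ≡⟨ cong (map (x ∷_)) (masks-++ n m) ⟩
    map (x ∷_) (concatMap glue M)                      ≡⟨ map-concatMap (x ∷_) glue M ⟩
    concatMap (λ I → map (x ∷_) (glue I)) M            ≡⟨ concatMap-cong (λ I → map-∘ (masks m)) M ⟨
    concatMap (glue ∘ (x ∷_)) M                        ≡⟨ concatMap-map glue (x ∷_) M ⟨
    concatMap glue (map (x ∷_) M)                      ∎

term : Word → List Bool → Word × Word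
term w I = pack (select I w) , pack (quot (select (map not I) w) (select I w))

_⋆²_ : Word × Word → Word × Word → Word × Word
(a , b) ⋆² (c , d) = a ⋆ c , b ⋆ d

term-⋆ : ∀ u v I J → length I ≡ length u → term (u ⋆ v) (I ++ J) ≡ term u I ⋆² term v J
term-⋆ u v I J |I|≡|u| = cong₂ _,_ left right
  where
  open ≡-Reasoning
  t : ℕ
  t = sup u
  a b c d : Word
  a = select I u
  b = select J v
  c = select (map not I) u
  d = select (map not J) v
  sup-a : sup a ≤ t
  sup-a = sup-select I u
  sup-c : sup c ≤ t
  sup-c = sup-select (map not I) u
  selected : select (I ++ J) (u ⋆ v) ≡ a ++ T t b
  selected = select-⋆ I J u v |I|≡|u|
  complement : select (map not (I ++ J)) (u ⋆ v) ≡ c ++ T t d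
  complement = trans (cong (λ K → select K (u ⋆ v)) (map-++ not I J))
                     (select-⋆ (map not I) (map not J) u v (trans (length-map not I) |I|≡|u|))
  left : pack (select (I ++ J) (u ⋆ v)) ≡ pack a ⋆ pack b
  left = trans (cong pack selected) (pack-shifted a b t sup-a)
  right : pack (quot (select (map not (I ++ J)) (u ⋆ v)) (select (I ++ J) (u ⋆ v)))
        ≡ pack (quot c a) ⋆ pack (quot d b)
  right = begin
    pack (quot (select (map not (I ++ J)) (u ⋆ v)) (select (I ++ J) (u ⋆ v)))
                                        ≡⟨ cong pack (cong₂ quot complement selected) ⟩
    pack (quot (c ++ T t d) (a ++ T t b)) ≡⟨ cong pack (quot-shifted a b c d t sup-a sup-c) ⟩
    pack (quot c a ++ T t (quot d b))     ≡⟨ pack-shifted (quot c a) (quot d b) t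
                                               (≤-trans (sup-map-≤ (erase a) (erase-≤ a) c) sup-c) ⟩
    pack (quot c a) ⋆ pack (quot d b)     ∎

concatMap-cong-on : ∀ {A B : Set} {P : A → Set} {f g : A → List B} {xs : List A} →
  All P xs → (∀ {x} → P x → f x ≡ g x) → concatMap f xs ≡ concatMap g xs
concatMap-cong-on []         _   = refl
concatMap-cong-on (px ∷ pxs) f≡g = cong₂ _++_ (f≡g px) (concatMap-cong-on pxs f≡g)

length-⋆ : ∀ u v → length (u ⋆ v) ≡ length u + length v
length-⋆ u v = trans (length-++ u) (cong (length u +_) (length-map (shift (sup u)) v))

Δ-⋆ : ∀ u v → Δ (u ⋆ v) ≡ Δ u ⋆⊗ Δ v
Δ-⋆ u v = begin
  map (term (u ⋆ v)) (masks (length (u ⋆ v)))                  ≡⟨ cong (map (term (u ⋆ v)) ∘ masks) (length-⋆ u v) ⟩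
  map (term (u ⋆ v)) (masks (n + m))                           ≡⟨ cong (map (term (u ⋆ v))) (masks-++ n m) ⟩
  map (term (u ⋆ v)) (concatMap (λ I → map (I ++_) M) N)     ≡⟨ map-concatMap (term (u ⋆ v)) (λ I → map (I ++_) M) N ⟩
  concatMap (λ I → map (term (u ⋆ v)) (map (I ++_) M)) N      ≡⟨ concatMap-cong-on (masks-length n) split ⟩
  concatMap (λ I → map (term u I ⋆²_) (map (term v) M)) N     ≡⟨ concatMap-map (λ p → map (p ⋆²_) (Δ v)) (term u) N ⟨
  Δ u ⋆⊗ Δ v                                                   ∎
  where
  open ≡-Reasoning
  n m : ℕ
  n = length u
  m = length v
  N M : List (List Bool)
  N = masks n
  M = masks m
  split : ∀ {I} → length I ≡ n →
    map (term (u ⋆ v)) (map (I ++_) M) ≡ map (term u I ⋆²_) (map (term v) M)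
  split {I} |I|≡n = begin
    map (term (u ⋆ v)) (map (I ++_) M)       ≡⟨ map-∘ M ⟨
    map (term (u ⋆ v) ∘ (I ++_)) M           ≡⟨ map-cong (λ J → term-⋆ u v I J |I|≡n) M ⟩
    map ((term u I ⋆²_) ∘ term v) M          ≡⟨ map-∘ M ⟩
    map (term u I ⋆²_) (map (term v) M)      ∎

proposition4 : {c ℓ : Level} (k : Field c ℓ) (u v : Word) → Packed u → Packed v →
    _≈⊗_ k (Δ (u ⋆ v)) (Δ u ⋆⊗ Δ v)
proposition4 k u v _ _ a b = Field.reflexive k (cong (coeff k a b) (Δ-⋆ u v))
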